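{- Let $\mathbf{x}=x_1\ldots\mathbf{u}$ and $\mathbf{y}=y_1\ldots\mathbf{u}$ be two adjacent vertices of $H_{\mathbf{n}}^k$ (with $\mathbf{u}$ possibly being the empty string). Then: (1) If $\mathbf{x}$ and $\mathbf{y}$ are adjacent by the rule $x_1\mathbf{w}\sim y_1\mathbf{w}$ with $x_1\neq y_1$ (they differ only in the first symbol), then either $\mathrm{alt}(\mathbf{x})=\mathrm{alt}(\mathbf{y})\pm 1$ if $x_1=0$ or $y_1=0$, or $\mathrm{alt}(\mathbf{x})=\mathrm{alt}(\mathbf{y})$ otherwise ($x_1,y_1\neq 0$). (2) If $\mathbf{x}$ and $\mathbf{y}$ are adjacent by the rule $\mathbf{0}\mathbf{w}\sim\mathbf{z}^*\mathbf{w}$, where $\mathbf{0}$ is an all-zero string and $\mathbf{z}^*$ is a string of the same length with all elements nonzero, then $\mathrm{alt}(\mathbf{x})=\mathrm{alt}(\mathbf{y})\pm 1$. (3) If $\mathbf{x}$ and $\mathbf{y}$ are adjacent by the rule $\mathbf{0}x_i^*\mathbf{w}\sim\mathbf{0}y_i^*\mathbf{w}$, where $\mathbf{0}$ is an all-zero string and $x_i^*,y_i^*$ are nonzero symbols with $y_i^*\neq x_i^*$, then $\mathrm{alt}(\mathbf{x})=\mathrm{alt}(\mathbf{y})$.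
   Context: Let $n_1,\ldots,n_k$ be integers $n_i\ge 2$. The hierarchical graph $H_{\mathbf{n}}^k=H_{n_1,\ldots,n_k}$ has as vertices the $k$-strings $x_1x_2\ldots x_k$ with $x_i\in\mathbb{Z}_{n_i}$. A string all of whose elements are nonzero is written $\mathbf{x}^*=x_1^*\ldots x_\ell^*$; a string with all elements $0$ is written $\mathbf{0}$. The edges are exactly given by the following three adjacency rules (substring lengths adding up to $k$): (A0) $x_1\mathbf{w}\sim y_1\mathbf{w}$ with $x_1\neq y_1$; (A1) $\mathbf{0}\mathbf{w}\sim\mathbf{z}^*\mathbf{w}$ with $|\mathbf{z}^*|=|\mathbf{0}|$; (A2) $\mathbf{0}x_i^*\mathbf{w}\sim\mathbf{0}y_i^*\mathbf{w}$ with $y_i^*\neq x_i^*$. For a vertex $\mathbf{x}=x_1\ldots x_k$, let $\mathbf{x}^+=x_1\ldots x_k0$ (append $x_{k+1}=0$); the alternating number $\mathrm{alt}(\mathbf{x})$ is the number of changes in $\mathbf{x}^+$ between consecutive elements from a zero element to a nonzero element or vice versa (e.g. $\mathrm{alt}(\mathbf{x}_1^*\mathbf{0}_2\mathbf{x}_3^*\mathbf{0}_4\mathbf{x}_5^*)=5$, $\mathrm{alt}(\mathbf{x}_1^*\mathbf{0}_2\mathbf{x}_3^*\mathbf{0}_4)=3$). -}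

module Defs where

open import Data.Nat using (ℕ; zero; suc; _+_; _≤_; _<_)
open import Data.Bool using (Bool; true; false; if_then_else_; _xor_)
open import Data.List using (List; []; _∷_; _++_; replicate; length; [_])
open import Data.List.Relation.Unary.All using (All)
open import Data.List.Relation.Binary.Pointwise using (Pointwise)
open import Data.Product using (Σ; _×_; ∃-syntax)
open import Data.Sum using (_⊎_)
open import Relation.Binary.PropositionalEquality using (_≡_; _≢_)

ValidParams : List ℕ → Set
ValidParams n = All (2 ≤_) n

-- A vertex of H_n^k: a k-string x₁…x_k with xᵢ ∈ ℤ_{nᵢ} = {0,…,nᵢ-1}.
IsVertex : List ℕ → List ℕ → Set
IsVertex n x = Pointwise _<_ x n

isZero : ℕ → Bool
isZero zero    = true
isZero (suc _) = false

changes : List ℕ → ℕ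
changes []            = 0
changes (a ∷ [])      = 0
changes (a ∷ b ∷ r)   = (if isZero a xor isZero b then 1 else 0) + changes (b ∷ r)

alt : List ℕ → ℕ
alt x = changes (x ++ [ 0 ])

A1Step : List ℕ → List ℕ → Set
A1Step x y = ∃[ z ] ∃[ w ] (z ≢ [] × All (λ c → c ≢ 0) z
               × x ≡ replicate (length z) 0 ++ w × y ≡ z ++ w)

AdjA1 : List ℕ → List ℕ → Set
AdjA1 x y = A1Step x y ⊎ A1Step y x

AdjA2 : List ℕ → List ℕ → Set
AdjA2 x y = ∃[ ℓ ] ∃[ a ] ∃[ b ] ∃[ w ] (a ≢ 0 × b ≢ 0 × a ≢ b
               × x ≡ replicate ℓ 0 ++ (a ∷ w) × y ≡ replicate ℓ 0 ++ (b ∷ w))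

-- alt x depends only on the zero pattern of x, which rule A2 and rule A0 between nonzero heads
-- preserve. A block of zeros or of nonzeros counts like a single symbol, so the two sides of
-- rule A1 behave like 0w and 1w; toggling the head between zero and nonzero adds or removes
-- exactly one change, at the boundary with the rest of w0.
module Submission where

open import Defs
open import Data.Nat using (ℕ; _+_; zero; suc)
open import Data.Nat.Properties using (+-comm)
open import Data.List using (List; _∷_; []; _++_; replicate; length; [_])
open import Data.List.Properties using (++-assoc)
open import Data.List.Relation.Unary.All using (All; []; _∷_)
open import Data.Product using (_×_; _,_)
open import Data.Sum using (_⊎_; inj₁; inj₂)
open import Data.Empty using (⊥-elim)
open import Relation.Binary.PropositionalEquality using (_≡_; _≢_; refl; sym; trans; cong; subst₂)

OffByOne : ℕ → ℕ → Set
OffByOne p q = p ≡ q + 1 ⊎ p + 1 ≡ q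

OffByOne-sym : ∀ {p q} → OffByOne p q → OffByOne q p
OffByOne-sym (inj₁ p≡q+1) = inj₂ (sym p≡q+1)
OffByOne-sym (inj₂ p+1≡q) = inj₁ (sym p+1≡q)

changes-swap-nonzero : ∀ p a b r → changes (p ++ suc a ∷ r) ≡ changes (p ++ suc b ∷ r)
changes-swap-nonzero []          a b []      = refl
changes-swap-nonzero []          a b (_ ∷ _) = refl
changes-swap-nonzero (c ∷ [])    a b r       = cong (_ +_) (changes-swap-nonzero [] a b r)
changes-swap-nonzero (c ∷ d ∷ p) a b r       = cong (_ +_) (changes-swap-nonzero (d ∷ p) a b r)

changes-zero-block : ∀ m r → changes (replicate (suc m) 0 ++ r) ≡ changes (0 ∷ r)
changes-zero-block zero    r = refl
changes-zero-block (suc m) r = changes-zero-block m r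

changes-nonzero-block : ∀ c z r → c ≢ 0 → All (_≢ 0) z → changes (c ∷ z ++ r) ≡ changes (1 ∷ r)
changes-nonzero-block zero    _             _ c≢0 _           = ⊥-elim (c≢0 refl)
changes-nonzero-block (suc _) (zero ∷ _)    _ _   (d≢0 ∷ _)   = ⊥-elim (d≢0 refl)
changes-nonzero-block (suc c) []            r _   []          = changes-swap-nonzero [] c 0 r
changes-nonzero-block (suc _) (suc d ∷ z)   r _   (d≢0 ∷ z≢0) = changes-nonzero-block (suc d) z r d≢0 z≢0

changes-toggle-head : ∀ a c r → OffByOne (changes (0 ∷ c ∷ r)) (changes (suc a ∷ c ∷ r))
changes-toggle-head a zero    r = inj₂ (+-comm (changes (0 ∷ r)) 1)
changes-toggle-head a (suc c) r = inj₁ (+-comm 1 (changes (suc c ∷ r)))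

alt-++ : ∀ p w → alt (p ++ w) ≡ changes (p ++ w ++ [ 0 ])
alt-++ p w = cong changes (++-assoc p w [ 0 ])

alt-toggle-head : ∀ a w → OffByOne (alt (0 ∷ w)) (alt (suc a ∷ w))
alt-toggle-head a []      = inj₂ refl
alt-toggle-head a (c ∷ w) = changes-toggle-head a c (w ++ [ 0 ])

alt-swap-nonzero : ∀ p a b w → alt (p ++ suc a ∷ w) ≡ alt (p ++ suc b ∷ w)
alt-swap-nonzero p a b w
  rewrite alt-++ p (suc a ∷ w) | alt-++ p (suc b ∷ w) = changes-swap-nonzero p a b (w ++ [ 0 ])

alt-head-nonzero : ∀ a b w → a ≢ 0 → b ≢ 0 → alt (a ∷ w) ≡ alt (b ∷ w)
alt-head-nonzero zero    _       _ a≢0 _   = ⊥-elim (a≢0 refl)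
alt-head-nonzero (suc a) zero    _ _   b≢0 = ⊥-elim (b≢0 refl)
alt-head-nonzero (suc a) (suc b) w _   _   = alt-swap-nonzero [] a b w

alt-head-zero : ∀ a b w → a ≢ b → a ≡ 0 ⊎ b ≡ 0 → OffByOne (alt (a ∷ w)) (alt (b ∷ w))
alt-head-zero zero    zero    _ a≢b _        = ⊥-elim (a≢b refl)
alt-head-zero zero    (suc b) w _   _        = alt-toggle-head b w
alt-head-zero (suc a) zero    w _   _        = OffByOne-sym (alt-toggle-head a w)
alt-head-zero (suc a) (suc b) _ _   (inj₁ ())
alt-head-zero (suc a) (suc b) _ _   (inj₂ ())

alt-zero-block : ∀ m w → alt (replicate (suc m) 0 ++ w) ≡ alt (0 ∷ w)
alt-zero-block m w = trans (alt-++ (replicate (suc m) 0) w) (changes-zero-block m (w ++ [ 0 ]))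

alt-nonzero-block : ∀ c z w → c ≢ 0 → All (_≢ 0) z → alt (c ∷ z ++ w) ≡ alt (1 ∷ w)
alt-nonzero-block c z w c≢0 z≢0 =
  trans (alt-++ (c ∷ z) w) (changes-nonzero-block c z (w ++ [ 0 ]) c≢0 z≢0)

alt-A1Step : ∀ {x y} → A1Step x y → OffByOne (alt x) (alt y)
alt-A1Step ([]    , _ , []≢[] , _ , _ , _) = ⊥-elim ([]≢[] refl)
alt-A1Step (c ∷ z , w , _ , c≢0 ∷ z≢0 , refl , refl) =
  subst₂ OffByOne
    (sym (alt-zero-block (length z) w))
    (sym (alt-nonzero-block c z w c≢0 z≢0))
    (alt-toggle-head 0 w)

alt-AdjA1 : ∀ {x y} → AdjA1 x y → OffByOne (alt x) (alt y)
alt-AdjA1 (inj₁ x↝y) = alt-A1Step x↝y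
alt-AdjA1 (inj₂ y↝x) = OffByOne-sym (alt-A1Step y↝x)

alt-AdjA2 : ∀ {x y} → AdjA2 x y → alt x ≡ alt y
alt-AdjA2 (_ , zero  , _     , _ , a≢0 , _)   = ⊥-elim (a≢0 refl)
alt-AdjA2 (_ , suc _ , zero  , _ , _ , b≢0 , _) = ⊥-elim (b≢0 refl)
alt-AdjA2 (ℓ , suc a , suc b , w , _ , _ , _ , refl , refl) = alt-swap-nonzero (replicate ℓ 0) a b w

mainTheorem3 : (n : List ℕ) → ValidParams n → (x y : List ℕ) → IsVertex n x → IsVertex n y →
    (((a b : ℕ) (w : List ℕ) → a ≢ b → x ≡ a ∷ w → y ≡ b ∷ w →
        ((a ≡ 0 ⊎ b ≡ 0) → (alt x ≡ alt y + 1 ⊎ alt x + 1 ≡ alt y))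
        × (a ≢ 0 → b ≢ 0 → alt x ≡ alt y))
    × (AdjA1 x y → (alt x ≡ alt y + 1 ⊎ alt x + 1 ≡ alt y))
    × (AdjA2 x y → alt x ≡ alt y))
mainTheorem3 _ _ x y _ _ =
  (λ { a b w a≢b refl refl → alt-head-zero a b w a≢b , alt-head-nonzero a b w })
  , alt-AdjA1
  , alt-AdjA2
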